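{- Let $n$, $t$ and $s$ be positive integers with $n\geq t+3$. Suppose $\mathcal{F}\subseteq \binom{[n]}{t+1}$ is an $s$-almost $t$-intersecting family which is not $t$-intersecting. Then: (i) if $|F_{1}\cap F_{2}|\geq t-1$ for all $F_{1},F_{2}\in\mathcal{F}$, then $|\mathcal{F}|\leq 2s+4$; (ii) if $|F_{1}\cap F_{2}|\leq t-2$ for some $F_{1},F_{2}\in\mathcal{F}$, then $|\mathcal{F}|\leq 2s$.
   Context: $\mathcal{F}\subseteq\binom{[n]}{k}$ is $s$-almost $t$-intersecting if $\left|\{F'\in\mathcal{F}: |F'\cap F|<t\}\right|\leq s$ for every $F\in\mathcal{F}$; it is $t$-intersecting if $|F\cap F'|\geq t$ for all $F,F'\in\mathcal{F}$. -}

module Defs where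

open import Data.Nat using (ℕ; _<_; _≤_; _≥_; _<?_)
open import Data.Fin.Subset using (Subset; _∩_; ∣_∣)
open import Data.List using (List; length; filter)
open import Data.List.Membership.Propositional using (_∈_)
open import Data.List.Relation.Unary.Unique.Propositional using (Unique)
open import Relation.Binary.PropositionalEquality using (_≡_)

record Family (n : ℕ) : Set where
  constructor family
  field
    members  : List (Subset n)
    distinct : Unique members
open Family public

size : ∀ {n} → Family n → ℕ
size 𝓕 = length (members 𝓕)

Uniform : ∀ {n} → ℕ → Family n → Set
Uniform k 𝓕 = ∀ F → F ∈ members 𝓕 → ∣ F ∣ ≡ k

badCount : ∀ {n} → ℕ → Family n → Subset n → ℕ
badCount t 𝓕 F = length (filter (λ F′ → ∣ F′ ∩ F ∣ <? t) (members 𝓕))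

AlmostIntersecting : ∀ {n} → ℕ → ℕ → Family n → Set
AlmostIntersecting s t 𝓕 = ∀ F → F ∈ members 𝓕 → badCount t 𝓕 F ≤ s

Intersecting : ∀ {n} → ℕ → Family n → Set
Intersecting t 𝓕 = ∀ F F′ → F ∈ members 𝓕 → F′ ∈ members 𝓕 → ∣ F ∩ F′ ∣ ≥ t

-- Fix a pair A, B of members with |A ∩ B| < t.  Every member either meets A or B in fewer
-- than t points (at most 2s members) or meets both in at least t points ("close to both").
-- If |A ∩ B| ≤ t - 2, no (t+1)-set is close to both, as |F ∩ A| + |F ∩ B| ≤ |F| + |A ∩ B|.
-- Otherwise that inequality is tight for every close F: then D = A ∩ B has t - 1 points,
-- D ⊆ F ⊆ A ∪ B, and F ∩ A, F ∩ B are atoms of the height-two intervals [D, A], [D, B].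
-- Such an interval has only two atoms (any two distinct ones are complements of each
-- other, and complements are unique in a distributive lattice), and F = (F ∩ A) ∪ (F ∩ B),
-- so there are at most 2 · 2 close sets.
module Submission where

open import Defs
open import Data.Nat using (ℕ; suc; _+_; _*_; _≤_; _≥_; _<_; z≤n; s≤s; _≤?_; _<?_)
open import Data.Nat.Properties
  using (≤-trans; ≤-reflexive; ≤-antisym; ≤-pred; n≮n; ≰⇒>; <-≤-connex; +-suc;
         +-mono-≤; +-monoˡ-≤; +-monoʳ-≤; +-cancelˡ-≤; +-cancelʳ-≤; +-cancelʳ-≡; n≤1+n;
         module ≤-Reasoning)
open import Data.Nat.Tactic.RingSolver using (solve-∀)
open import Data.Bool using () renaming (_≟_ to _≟ᵇ_)
open import Data.Vec using ([]; _∷_; here)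
open import Data.Vec.Properties using (≡-dec)
open import Data.Fin.Subset using (Subset; _∩_; _∪_; _⊆_; ∣_∣; inside; outside)
open import Data.Fin.Subset.Properties
  using (p∩q⊆p; p∩q⊆q; x∈p∩q⁺; x∈p∪q⁻; drop-∷-⊆; p⊆q⇒∣p∣≤∣q∣; ⊆-trans; ∪-∩-distributiveLattice)
open import Data.List using (List; []; _∷_; length; filter)
open import Data.List.Membership.Propositional using (_∈_; find)
open import Data.List.Membership.Propositional.Properties using (∈-filter⁻)
open import Data.List.Properties using (filter-all; filter-none)
open import Data.List.Relation.Binary.Subset.Propositional using () renaming (_⊆_ to _⊆ˡ_)
open import Data.List.Relation.Binary.Subset.Propositional.Properties using (filter-⊆)
open import Data.List.Relation.Unary.All as All using (All; all?; _∷_)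
open import Data.List.Relation.Unary.All.Properties using (¬All⇒Any¬)
open import Data.List.Relation.Unary.Any using (here; there)
open import Data.List.Relation.Unary.AllPairs using (_∷_)
open import Data.List.Relation.Unary.Unique.Propositional using (Unique)
open import Data.List.Relation.Unary.Unique.Propositional.Properties using (filter⁺)
open import Data.Product using (_×_; _,_; proj₁; proj₂; ∃-syntax; Σ-syntax)
open import Data.Sum using (_⊎_; inj₁; inj₂; [_,_])
open import Algebra.Lattice.Bundles using (DistributiveLattice)
open import Level using (0ℓ)
open import Relation.Binary.Definitions using (DecidableEquality)
open import Relation.Binary.PropositionalEquality
  using (_≡_; _≢_; refl; sym; trans; cong; cong₂; subst; module ≡-Reasoning)
open import Relation.Nullary using (¬_; yes; no; contradiction)
open import Relation.Nullary.Decidable using (toSum; _×-dec_)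
open import Relation.Unary using (Pred; Decidable)
open import Relation.Unary.Properties using (_∪?_; ∁?)

module _ {A : Set} {P Q : Pred A 0ℓ} (P? : Decidable P) (Q? : Decidable Q) where

  length-filter-∪ : ∀ xs → length (filter (P? ∪? Q?) xs) ≤ length (filter P? xs) + length (filter Q? xs)
  length-filter-∪ [] = z≤n
  length-filter-∪ (x ∷ xs) with ih ← length-filter-∪ xs | P? x | Q? x
  ... | yes _ | yes _ = s≤s (≤-trans ih (+-monoʳ-≤ _ (n≤1+n _)))
  ... | yes _ | no  _ = s≤s ih
  ... | no  _ | yes _ = ≤-trans (s≤s ih) (≤-reflexive (sym (+-suc _ _)))
  ... | no  _ | no  _ = ih

  length≤filter+filter : (∀ x → P x ⊎ Q x) → ∀ xs → length xs ≤ length (filter P? xs) + length (filter Q? xs)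
  length≤filter+filter P∪Q xs = begin
    length xs                                     ≡⟨ cong length (filter-all (P? ∪? Q?) {xs} (All.tabulate λ {x} _ → P∪Q x)) ⟨
    length (filter (P? ∪? Q?) xs)                 ≤⟨ length-filter-∪ xs ⟩
    length (filter P? xs) + length (filter Q? xs) ∎
    where open ≤-Reasoning

module _ {A : Set} where

  length≤1 : ∀ {xs : List A} → Unique xs → (∀ {x y} → x ∈ xs → y ∈ xs → x ≡ y) → length xs ≤ 1
  length≤1 {[]}        _               _    = z≤n
  length≤1 {_ ∷ []}    _               _    = s≤s z≤n
  length≤1 {_ ∷ _ ∷ _} ((x≢y ∷ _) ∷ _) all≡ = contradiction (all≡ (here refl) (there (here refl))) x≢y

module _ {A B : Set} where

  Constant : (A → B) → List A → Set
  Constant f xs = ∀ {x y} → x ∈ xs → y ∈ xs → f x ≡ f y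

  AtMostTwoValues : (A → B) → List A → Set
  AtMostTwoValues f xs = ∀ {x y z} → x ∈ xs → y ∈ xs → z ∈ xs → f x ≢ f z → f y ≢ f z → f x ≡ f y

  length≤m+m : DecidableEquality B → ∀ {f : A → B} {xs : List A} {m} → Unique xs → AtMostTwoValues f xs →
    (∀ {ys} → ys ⊆ˡ xs → Unique ys → Constant f ys → length ys ≤ m) → length xs ≤ m + m
  length≤m+m _≟_ {xs = []} _ _ _ = z≤n
  length≤m+m _≟_ {f} {xs@(z ∷ _)} {m} unique atMostTwo bound = begin
    length xs                                          ≤⟨ length≤filter+filter P? (∁? P?) (λ x → toSum (P? x)) xs ⟩
    length (filter P? xs) + length (filter (∁? P?) xs) ≤⟨ +-mono-≤ (side P? valueAtZ) (side (∁? P?) otherValue) ⟩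
    m + m                                              ∎
    where
    open ≤-Reasoning
    P? : Decidable (λ x → f x ≡ f z)
    P? x = f x ≟ f z
    side : ∀ {S} (S? : Decidable S) → Constant f (filter S? xs) → length (filter S? xs) ≤ m
    side S? = bound (filter-⊆ S? xs) (filter⁺ S? unique)
    valueAtZ : Constant f (filter P? xs)
    valueAtZ x∈ y∈ = trans (proj₂ (∈-filter⁻ P? x∈)) (sym (proj₂ (∈-filter⁻ P? y∈)))
    otherValue : Constant f (filter (∁? P?) xs)
    otherValue x∈ y∈ with x∈xs , fx≢fz ← ∈-filter⁻ (∁? P?) x∈ | y∈xs , fy≢fz ← ∈-filter⁻ (∁? P?) y∈ =
      atMostTwo x∈xs y∈xs (here refl) fx≢fz fy≢fz

module _ {c ℓ} (L : DistributiveLattice c ℓ) where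
  open DistributiveLattice L using (_≈_; _∧_; _∨_; setoid; ∧-absorbs-∨; ∧-congˡ; ∧-distribˡ-∨; ∨-cong; ∧-comm)
  open import Relation.Binary.Reasoning.Setoid setoid

  ∧-∨-cancelʳ : ∀ x y z → x ∧ z ≈ y ∧ z → x ∨ z ≈ y ∨ z → x ≈ y
  ∧-∨-cancelʳ x y z x∧z≈y∧z x∨z≈y∨z = begin
    x                 ≈⟨ ∧-absorbs-∨ x z ⟨
    x ∧ (x ∨ z)       ≈⟨ ∧-congˡ x∨z≈y∨z ⟩
    x ∧ (y ∨ z)       ≈⟨ ∧-distribˡ-∨ x y z ⟩
    (x ∧ y) ∨ (x ∧ z) ≈⟨ ∨-cong (∧-comm x y) x∧z≈y∧z ⟩
    (y ∧ x) ∨ (y ∧ z) ≈⟨ ∧-distribˡ-∨ y x z ⟨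
    y ∧ (x ∨ z)       ≈⟨ ∧-congˡ x∨z≈y∨z ⟩
    y ∧ (y ∨ z)       ≈⟨ ∧-absorbs-∨ y z ⟩
    y                 ∎

private
  variable
    n k : ℕ
    p q r A B D F X Y Z : Subset n

∣p∪q∣+∣p∩q∣≡∣p∣+∣q∣ : ∀ (p q : Subset n) → ∣ p ∪ q ∣ + ∣ p ∩ q ∣ ≡ ∣ p ∣ + ∣ q ∣
∣p∪q∣+∣p∩q∣≡∣p∣+∣q∣ []            []            = refl
∣p∪q∣+∣p∩q∣≡∣p∣+∣q∣ (inside  ∷ p) (inside  ∷ q) =
  cong suc (trans (+-suc _ _) (trans (cong suc (∣p∪q∣+∣p∩q∣≡∣p∣+∣q∣ p q)) (sym (+-suc _ _))))
∣p∪q∣+∣p∩q∣≡∣p∣+∣q∣ (inside  ∷ p) (outside ∷ q) = cong suc (∣p∪q∣+∣p∩q∣≡∣p∣+∣q∣ p q)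
∣p∪q∣+∣p∩q∣≡∣p∣+∣q∣ (outside ∷ p) (inside  ∷ q) = trans (cong suc (∣p∪q∣+∣p∩q∣≡∣p∣+∣q∣ p q)) (sym (+-suc _ _))
∣p∪q∣+∣p∩q∣≡∣p∣+∣q∣ (outside ∷ p) (outside ∷ q) = ∣p∪q∣+∣p∩q∣≡∣p∣+∣q∣ p q

p⊆q∧∣q∣≤∣p∣⇒p≡q : p ⊆ q → ∣ q ∣ ≤ ∣ p ∣ → p ≡ q
p⊆q∧∣q∣≤∣p∣⇒p≡q {p = []}          {[]}          _   _              = refl
p⊆q∧∣q∣≤∣p∣⇒p≡q {p = outside ∷ p} {outside ∷ q} p⊆q ∣q∣≤∣p∣       =
  cong (outside ∷_) (p⊆q∧∣q∣≤∣p∣⇒p≡q (drop-∷-⊆ p⊆q) ∣q∣≤∣p∣)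
p⊆q∧∣q∣≤∣p∣⇒p≡q {p = outside ∷ p} {inside  ∷ q} p⊆q ∣q∣<∣p∣       =
  contradiction (≤-trans ∣q∣<∣p∣ (p⊆q⇒∣p∣≤∣q∣ (drop-∷-⊆ p⊆q))) (n≮n _)
p⊆q∧∣q∣≤∣p∣⇒p≡q {p = inside  ∷ p} {outside ∷ q} p⊆q _              = contradiction (p⊆q here) λ ()
p⊆q∧∣q∣≤∣p∣⇒p≡q {p = inside  ∷ p} {inside  ∷ q} p⊆q (s≤s ∣q∣≤∣p∣) =
  cong (inside ∷_) (p⊆q∧∣q∣≤∣p∣⇒p≡q (drop-∷-⊆ p⊆q) ∣q∣≤∣p∣)

∣p∣≤∣p∩q∣⇒p⊆q : ∀ (p q : Subset n) → ∣ p ∣ ≤ ∣ p ∩ q ∣ → p ⊆ q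
∣p∣≤∣p∩q∣⇒p⊆q p q ∣p∣≤∣p∩q∣ = subst (_⊆ q) (p⊆q∧∣q∣≤∣p∣⇒p≡q (p∩q⊆p p q) ∣p∣≤∣p∩q∣) (p∩q⊆q p q)

∪-least : p ⊆ r → q ⊆ r → p ∪ q ⊆ r
∪-least {p = p} {q = q} p⊆r q⊆r x∈p∪q = [ p⊆r , q⊆r ] (x∈p∪q⁻ p q x∈p∪q)

∩-greatest : r ⊆ p → r ⊆ q → r ⊆ p ∩ q
∩-greatest r⊆p r⊆q x∈r = x∈p∩q⁺ (r⊆p x∈r , r⊆q x∈r)

p∩q∪p∩r⊆p : ∀ (p q r : Subset n) → (p ∩ q) ∪ (p ∩ r) ⊆ p
p∩q∪p∩r⊆p p q r = ∪-least (p∩q⊆p p q) (p∩q⊆p p r)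

p∩q∩p∩r⊆q∩r : ∀ (p q r : Subset n) → (p ∩ q) ∩ (p ∩ r) ⊆ q ∩ r
p∩q∩p∩r⊆q∩r p q r = ∩-greatest (⊆-trans (p∩q⊆p _ _) (p∩q⊆q p q)) (⊆-trans (p∩q⊆q _ _) (p∩q⊆q p r))

∣p∩q∣+∣p∩r∣≤∣p∣+∣q∩r∣ : ∀ (p q r : Subset n) → ∣ p ∩ q ∣ + ∣ p ∩ r ∣ ≤ ∣ p ∣ + ∣ q ∩ r ∣
∣p∩q∣+∣p∩r∣≤∣p∣+∣q∩r∣ p q r = begin
  ∣ p ∩ q ∣ + ∣ p ∩ r ∣                         ≡⟨ ∣p∪q∣+∣p∩q∣≡∣p∣+∣q∣ (p ∩ q) (p ∩ r) ⟨
  ∣ (p ∩ q) ∪ (p ∩ r) ∣ + ∣ (p ∩ q) ∩ (p ∩ r) ∣ ≤⟨ +-mono-≤ (p⊆q⇒∣p∣≤∣q∣ (p∩q∪p∩r⊆p p q r))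
                                                             (p⊆q⇒∣p∣≤∣q∣ (p∩q∩p∩r⊆q∩r p q r)) ⟩
  ∣ p ∣ + ∣ q ∩ r ∣                             ∎
  where open ≤-Reasoning

record Atom (D A X : Subset n) : Set where
  field
    lower : D ⊆ X
    upper : X ⊆ A
    card  : ∣ X ∣ ≡ suc ∣ D ∣

module HeightTwoInterval {n} {D A : Subset n} (∣A∣≡2+∣D∣ : ∣ A ∣ ≡ 2 + ∣ D ∣) where

  distinct-atoms-complementary : Atom D A X → Atom D A Y → X ≢ Y → X ∩ Y ≡ D × X ∪ Y ≡ A
  distinct-atoms-complementary {X = X} {Y = Y} atomX atomY X≢Y = X∩Y≡D , X∪Y≡A
    where
    module X = Atom atomX
    module Y = Atom atomY

    ∣X∩Y∣≤∣D∣ : ∣ X ∩ Y ∣ ≤ ∣ D ∣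
    ∣X∩Y∣≤∣D∣ = ≤-pred (≰⇒> λ ∣X∣≤∣X∩Y∣ →
      X≢Y (p⊆q∧∣q∣≤∣p∣⇒p≡q (∣p∣≤∣p∩q∣⇒p⊆q X Y (subst (_≤ ∣ X ∩ Y ∣) (sym X.card) ∣X∣≤∣X∩Y∣))
                           (≤-reflexive (trans Y.card (sym X.card)))))

    X∩Y≡D : X ∩ Y ≡ D
    X∩Y≡D = sym (p⊆q∧∣q∣≤∣p∣⇒p≡q (∩-greatest X.lower Y.lower) ∣X∩Y∣≤∣D∣)

    ∣X∪Y∣≡2+∣D∣ : ∣ X ∪ Y ∣ ≡ 2 + ∣ D ∣
    ∣X∪Y∣≡2+∣D∣ = +-cancelʳ-≡ ∣ D ∣ _ _ (begin
      ∣ X ∪ Y ∣ + ∣ D ∣     ≡⟨ cong (λ d → ∣ X ∪ Y ∣ + ∣ d ∣) X∩Y≡D ⟨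
      ∣ X ∪ Y ∣ + ∣ X ∩ Y ∣ ≡⟨ ∣p∪q∣+∣p∩q∣≡∣p∣+∣q∣ X Y ⟩
      ∣ X ∣ + ∣ Y ∣         ≡⟨ cong₂ _+_ X.card Y.card ⟩
      suc ∣ D ∣ + suc ∣ D ∣ ≡⟨ cong suc (+-suc ∣ D ∣ ∣ D ∣) ⟩
      2 + ∣ D ∣ + ∣ D ∣     ∎)
      where open ≡-Reasoning

    X∪Y≡A : X ∪ Y ≡ A
    X∪Y≡A = p⊆q∧∣q∣≤∣p∣⇒p≡q (∪-least X.upper Y.upper) (≤-reflexive (trans ∣A∣≡2+∣D∣ (sym ∣X∪Y∣≡2+∣D∣)))

  atMostTwoAtoms : Atom D A X → Atom D A Y → Atom D A Z → X ≢ Z → Y ≢ Z → X ≡ Y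
  atMostTwoAtoms {X = X} {Y = Y} {Z = Z} atomX atomY atomZ X≢Z Y≢Z
    with X∩Z≡D , X∪Z≡A ← distinct-atoms-complementary atomX atomZ X≢Z
       | Y∩Z≡D , Y∪Z≡A ← distinct-atoms-complementary atomY atomZ Y≢Z
    = ∧-∨-cancelʳ (∪-∩-distributiveLattice n) X Y Z (trans X∩Z≡D (sym Y∩Z≡D)) (trans X∪Z≡A (sym Y∪Z≡A))

+-mono-≤-tight : ∀ {m m′ n n′} → m ≤ m′ → n ≤ n′ → m′ + n′ ≤ m + n → m ≡ m′ × n ≡ n′
+-mono-≤-tight {m} {m′} {n} {n′} m≤m′ n≤n′ m′+n′≤m+n =
  ≤-antisym m≤m′ (+-cancelʳ-≤ n′ m′ m (≤-trans m′+n′≤m+n (+-monoʳ-≤ m n≤n′))) ,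
  ≤-antisym n≤n′ (+-cancelˡ-≤ m′ n′ n (≤-trans m′+n′≤m+n (+-monoˡ-≤ n m≤m′)))

CloseToBoth : ℕ → Subset n → Subset n → Subset n → Set
CloseToBoth t A B F = t ≤ ∣ F ∩ A ∣ × t ≤ ∣ F ∩ B ∣

closeToBoth? : ∀ t (A B : Subset n) → Decidable (CloseToBoth t A B)
closeToBoth? t A B F = (t ≤? ∣ F ∩ A ∣) ×-dec (t ≤? ∣ F ∩ B ∣)

¬closeToBoth : ∀ {t} → ∣ F ∣ ≡ suc t → ∣ A ∩ B ∣ + 2 ≤ t → ¬ CloseToBoth t A B F
¬closeToBoth {F = F} {A = A} {B = B} {t = t} ∣F∣≡1+t ∣A∩B∣+2≤t (t≤∣F∩A∣ , t≤∣F∩B∣) = n≮n _ (begin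
  suc (suc t + ∣ A ∩ B ∣)   ≡⟨ rearrange t ∣ A ∩ B ∣ ⟩
  ∣ A ∩ B ∣ + 2 + t         ≤⟨ +-monoˡ-≤ t ∣A∩B∣+2≤t ⟩
  t + t                     ≤⟨ +-mono-≤ t≤∣F∩A∣ t≤∣F∩B∣ ⟩
  ∣ F ∩ A ∣ + ∣ F ∩ B ∣     ≤⟨ ∣p∩q∣+∣p∩r∣≤∣p∣+∣q∩r∣ F A B ⟩
  ∣ F ∣ + ∣ A ∩ B ∣         ≡⟨ cong (_+ ∣ A ∩ B ∣) ∣F∣≡1+t ⟩
  suc t + ∣ A ∩ B ∣         ∎)
  where
  open ≤-Reasoning
  rearrange : ∀ t c → suc (suc t + c) ≡ c + 2 + t
  rearrange = solve-∀

module CloseToFarPair {n k} {A B F : Subset n} (∣F∣≡2+k : ∣ F ∣ ≡ 2 + k) (∣A∩B∣≤k : ∣ A ∩ B ∣ ≤ k)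
                   (close : CloseToBoth (suc k) A B F) where

  private
    U = (F ∩ A) ∪ (F ∩ B)
    I = (F ∩ A) ∩ (F ∩ B)

    ∣F∩A∣+∣F∩B∣≡∣U∣+∣I∣ : ∣ F ∩ A ∣ + ∣ F ∩ B ∣ ≡ ∣ U ∣ + ∣ I ∣
    ∣F∩A∣+∣F∩B∣≡∣U∣+∣I∣ = sym (∣p∪q∣+∣p∩q∣≡∣p∣+∣q∣ (F ∩ A) (F ∩ B))

    ∣U∣≤2+k : ∣ U ∣ ≤ 2 + k
    ∣U∣≤2+k = ≤-trans (p⊆q⇒∣p∣≤∣q∣ (p∩q∪p∩r⊆p F A B)) (≤-reflexive ∣F∣≡2+k)

    ∣I∣≤k : ∣ I ∣ ≤ k
    ∣I∣≤k = ≤-trans (p⊆q⇒∣p∣≤∣q∣ (p∩q∩p∩r⊆q∩r F A B)) ∣A∩B∣≤k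

    2+k+k≡1+k+1+k : 2 + k + k ≡ suc k + suc k
    2+k+k≡1+k+1+k = cong suc (sym (+-suc k k))

    -- 2k + 2 ≤ ∣F ∩ A∣ + ∣F ∩ B∣ = ∣U∣ + ∣I∣ ≤ 2k + 2, so every bound in this chain is attained.
    1+k≡∣F∩A∣×1+k≡∣F∩B∣ : suc k ≡ ∣ F ∩ A ∣ × suc k ≡ ∣ F ∩ B ∣
    1+k≡∣F∩A∣×1+k≡∣F∩B∣ = +-mono-≤-tight (proj₁ close) (proj₂ close) (begin
      ∣ F ∩ A ∣ + ∣ F ∩ B ∣ ≡⟨ ∣F∩A∣+∣F∩B∣≡∣U∣+∣I∣ ⟩
      ∣ U ∣ + ∣ I ∣         ≤⟨ +-mono-≤ ∣U∣≤2+k ∣I∣≤k ⟩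
      2 + k + k             ≡⟨ 2+k+k≡1+k+1+k ⟩
      suc k + suc k         ∎)
      where open ≤-Reasoning

    ∣U∣≡2+k×∣I∣≡k : ∣ U ∣ ≡ 2 + k × ∣ I ∣ ≡ k
    ∣U∣≡2+k×∣I∣≡k = +-mono-≤-tight ∣U∣≤2+k ∣I∣≤k (begin
      2 + k + k             ≡⟨ 2+k+k≡1+k+1+k ⟩
      suc k + suc k         ≤⟨ +-mono-≤ (proj₁ close) (proj₂ close) ⟩
      ∣ F ∩ A ∣ + ∣ F ∩ B ∣ ≡⟨ ∣F∩A∣+∣F∩B∣≡∣U∣+∣I∣ ⟩
      ∣ U ∣ + ∣ I ∣         ∎)
      where open ≤-Reasoning

    I≡A∩B : I ≡ A ∩ B
    I≡A∩B = p⊆q∧∣q∣≤∣p∣⇒p≡q (p∩q∩p∩r⊆q∩r F A B) (≤-trans ∣A∩B∣≤k (≤-reflexive (sym (proj₂ ∣U∣≡2+k×∣I∣≡k))))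

  F≡F∩A∪F∩B : F ≡ (F ∩ A) ∪ (F ∩ B)
  F≡F∩A∪F∩B = sym (p⊆q∧∣q∣≤∣p∣⇒p≡q (p∩q∪p∩r⊆p F A B) (≤-reflexive (trans ∣F∣≡2+k (sym (proj₁ ∣U∣≡2+k×∣I∣≡k)))))

  ∣A∩B∣≡k : ∣ A ∩ B ∣ ≡ k
  ∣A∩B∣≡k = trans (cong ∣_∣ (sym I≡A∩B)) (proj₂ ∣U∣≡2+k×∣I∣≡k)

  atomᴬ : Atom (A ∩ B) A (F ∩ A)
  atomᴬ = record
    { lower = subst (_⊆ F ∩ A) I≡A∩B (p∩q⊆p (F ∩ A) (F ∩ B))
    ; upper = p∩q⊆q F A
    ; card  = trans (sym (proj₁ 1+k≡∣F∩A∣×1+k≡∣F∩B∣)) (cong suc (sym ∣A∩B∣≡k))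
    }

  atomᴮ : Atom (A ∩ B) B (F ∩ B)
  atomᴮ = record
    { lower = subst (_⊆ F ∩ B) I≡A∩B (p∩q⊆q (F ∩ A) (F ∩ B))
    ; upper = p∩q⊆q F B
    ; card  = trans (sym (proj₂ 1+k≡∣F∩A∣×1+k≡∣F∩B∣)) (cong suc (sym ∣A∩B∣≡k))
    }

closeToBoth-length≤4 : ∣ A ∣ ≡ 2 + k → ∣ B ∣ ≡ 2 + k → ∣ A ∩ B ∣ ≤ k → ∀ {Fs} → Unique Fs →
  (∀ {F} → F ∈ Fs → ∣ F ∣ ≡ 2 + k × CloseToBoth (suc k) A B F) → length Fs ≤ 4
closeToBoth-length≤4 {A = A} {B = B} ∣A∣≡2+k ∣B∣≡2+k ∣A∩B∣≤k {Fs} unique close =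
  length≤m+m _≟_ unique atMostTwoᴬ λ ys⊆Fs unique-ys sameᴬ →
  length≤m+m _≟_ {f = _∩ B} unique-ys (λ x∈ y∈ z∈ → atMostTwoᴮ (ys⊆Fs x∈) (ys⊆Fs y∈) (ys⊆Fs z∈))
    λ zs⊆ys unique-zs sameᴮ → length≤1 unique-zs λ F∈ G∈ →
      separating (ys⊆Fs (zs⊆ys F∈)) (ys⊆Fs (zs⊆ys G∈)) (sameᴬ (zs⊆ys F∈) (zs⊆ys G∈)) (sameᴮ F∈ G∈)
  where
  _≟_ : DecidableEquality (Subset _)
  _≟_ = ≡-dec _≟ᵇ_
  module Close {F} (F∈ : F ∈ Fs) = CloseToFarPair {A = A} {B} {F} (proj₁ (close F∈)) ∣A∩B∣≤k (proj₂ (close F∈))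
  atMostTwoᴬ : AtMostTwoValues (_∩ A) Fs
  atMostTwoᴬ F∈ G∈ H∈ = atMostTwoAtoms (Close.atomᴬ F∈) (Close.atomᴬ G∈) (Close.atomᴬ H∈)
    where open HeightTwoInterval {D = A ∩ B} {A} (trans ∣A∣≡2+k (cong (2 +_) (sym (Close.∣A∩B∣≡k F∈))))
  atMostTwoᴮ : AtMostTwoValues (_∩ B) Fs
  atMostTwoᴮ F∈ G∈ H∈ = atMostTwoAtoms (Close.atomᴮ F∈) (Close.atomᴮ G∈) (Close.atomᴮ H∈)
    where open HeightTwoInterval {D = A ∩ B} {B} (trans ∣B∣≡2+k (cong (2 +_) (sym (Close.∣A∩B∣≡k F∈))))
  separating : ∀ {F G} → F ∈ Fs → G ∈ Fs → F ∩ A ≡ G ∩ A → F ∩ B ≡ G ∩ B → F ≡ G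
  separating F∈ G∈ F∩A≡G∩A F∩B≡G∩B =
    trans (Close.F≡F∩A∪F∩B F∈) (trans (cong₂ _∪_ F∩A≡G∩A F∩B≡G∩B) (sym (Close.F≡F∩A∪F∩B G∈)))

closeToBothMembers : ℕ → Subset n → Subset n → Family n → List (Subset n)
closeToBothMembers t A B 𝓕 = filter (closeToBoth? t A B) (members 𝓕)

size≤badCount+badCount+closeToBoth : ∀ t (𝓕 : Family n) A B →
  size 𝓕 ≤ badCount t 𝓕 A + (badCount t 𝓕 B + length (closeToBothMembers t A B 𝓕))
size≤badCount+badCount+closeToBoth t 𝓕 A B = begin
  size 𝓕
    ≤⟨ length≤filter+filter (far? A) (far? B ∪? closeToBoth? t A B) classify (members 𝓕) ⟩
  badCount t 𝓕 A + length (filter (far? B ∪? closeToBoth? t A B) (members 𝓕))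
    ≤⟨ +-monoʳ-≤ (badCount t 𝓕 A) (length-filter-∪ (far? B) (closeToBoth? t A B) (members 𝓕)) ⟩
  badCount t 𝓕 A + (badCount t 𝓕 B + length (closeToBothMembers t A B 𝓕))
    ∎
  where
  open ≤-Reasoning
  far? : ∀ X → Decidable (λ F → ∣ F ∩ X ∣ < t)
  far? X F = ∣ F ∩ X ∣ <? t
  classify : ∀ F → ∣ F ∩ A ∣ < t ⊎ ∣ F ∩ B ∣ < t ⊎ CloseToBoth t A B F
  classify F with <-≤-connex ∣ F ∩ A ∣ t | <-≤-connex ∣ F ∩ B ∣ t
  ... | inj₁ farA  | _          = inj₁ farA
  ... | inj₂ _     | inj₁ farB  = inj₂ (inj₁ farB)
  ... | inj₂ nearA | inj₂ nearB = inj₂ (inj₂ (nearA , nearB))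

¬Intersecting⇒farPair : ∀ {t} {𝓕 : Family n} → ¬ Intersecting t 𝓕 →
  ∃[ A ] ∃[ B ] A ∈ members 𝓕 × B ∈ members 𝓕 × ∣ A ∩ B ∣ < t
¬Intersecting⇒farPair {t = t} {𝓕} ¬intersecting
  with A , A∈ , ¬allB ← find (¬All⇒Any¬ (λ A → all? (λ B → t ≤? ∣ A ∩ B ∣) (members 𝓕)) (members 𝓕)
                               λ all → ¬intersecting λ A B A∈ B∈ → All.lookup (All.lookup all A∈) B∈)
  with B , B∈ , far ← find (¬All⇒Any¬ (λ B → t ≤? ∣ A ∩ B ∣) (members 𝓕) ¬allB)
  = A , B , A∈ , B∈ , ≰⇒> far

size≤2s+4 : ∀ {s} {𝓕 : Family n} → Uniform (2 + k) 𝓕 → AlmostIntersecting s (suc k) 𝓕 →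
  ¬ Intersecting (suc k) 𝓕 → size 𝓕 ≤ 2 * s + 4
size≤2s+4 {k = k} {s} {𝓕} uniform almost ¬intersecting
  with A , B , A∈ , B∈ , ∣A∩B∣<1+k ← ¬Intersecting⇒farPair {t = suc k} {𝓕} ¬intersecting = begin
  size 𝓕                                 ≤⟨ size≤badCount+badCount+closeToBoth (suc k) 𝓕 A B ⟩
  badCount (suc k) 𝓕 A + (badCount (suc k) 𝓕 B + length (closeToBothMembers (suc k) A B 𝓕))
                                         ≤⟨ +-mono-≤ (almost A A∈) (+-mono-≤ (almost B B∈) atMost4) ⟩
  s + (s + 4)                            ≡⟨ rearrange s ⟩
  2 * s + 4                              ∎
  where
  open ≤-Reasoning
  rearrange : ∀ s → s + (s + 4) ≡ 2 * s + 4
  rearrange = solve-∀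
  atMost4 : length (closeToBothMembers (suc k) A B 𝓕) ≤ 4
  atMost4 = closeToBoth-length≤4 (uniform A A∈) (uniform B B∈) (≤-pred ∣A∩B∣<1+k)
    (filter⁺ (closeToBoth? (suc k) A B) (distinct 𝓕))
    λ F∈ → let F∈𝓕 , close = ∈-filter⁻ (closeToBoth? (suc k) A B) F∈ in uniform _ F∈𝓕 , close

size≤2s : ∀ {t s} {𝓕 : Family n} → Uniform (suc t) 𝓕 → AlmostIntersecting s t 𝓕 →
  ∀ {F₁ F₂} → F₁ ∈ members 𝓕 → F₂ ∈ members 𝓕 → ∣ F₁ ∩ F₂ ∣ + 2 ≤ t → size 𝓕 ≤ 2 * s
size≤2s {t = t} {s} {𝓕} uniform almost {F₁} {F₂} F₁∈ F₂∈ ∣F₁∩F₂∣+2≤t = begin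
  size 𝓕                                 ≤⟨ size≤badCount+badCount+closeToBoth t 𝓕 F₁ F₂ ⟩
  badCount t 𝓕 F₁ + (badCount t 𝓕 F₂ + length (closeToBothMembers t F₁ F₂ 𝓕))
                                         ≤⟨ +-mono-≤ (almost F₁ F₁∈) (+-mono-≤ (almost F₂ F₂∈) none) ⟩
  2 * s                                  ∎
  where
  open ≤-Reasoning
  none : length (closeToBothMembers t F₁ F₂ 𝓕) ≤ 0
  none = ≤-reflexive (cong length (filter-none (closeToBoth? t F₁ F₂)
           (All.tabulate λ {F} F∈ → ¬closeToBoth {F = F} {A = F₁} {B = F₂} (uniform F F∈) ∣F₁∩F₂∣+2≤t)))

lemma3p3 : (n t s : ℕ) → 1 ≤ n → 1 ≤ t → 1 ≤ s → n ≥ t + 3 →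
    (𝓕 : Family n) → Uniform (suc t) 𝓕 → AlmostIntersecting s t 𝓕 → ¬ Intersecting t 𝓕 →
    ((∀ F₁ F₂ → F₁ ∈ members 𝓕 → F₂ ∈ members 𝓕 → ∣ F₁ ∩ F₂ ∣ + 1 ≥ t) → size 𝓕 ≤ 2 * s + 4)
    × ((Σ[ F₁ ∈ Subset n ] Σ[ F₂ ∈ Subset n ] (F₁ ∈ members 𝓕 × F₂ ∈ members 𝓕 × ∣ F₁ ∩ F₂ ∣ + 2 ≤ t)) → size 𝓕 ≤ 2 * s)
lemma3p3 n (suc k) s _ _ _ _ 𝓕 uniform almost ¬intersecting =
  (λ _ → size≤2s+4 {k = k} {s} {𝓕} uniform almost ¬intersecting) ,
  (λ (_ , _ , F₁∈ , F₂∈ , ∣F₁∩F₂∣+2≤t) → size≤2s {t = suc k} {s} {𝓕} uniform almost F₁∈ F₂∈ ∣F₁∩F₂∣+2≤t)
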